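{- Let $T \subseteq S$ be a set of permutations of any length and let $n \geq 1$. Then $$\langle S_n(T)\rangle = \langle S_n(T^{ -1})\rangle = \langle S_n(T)\cup S_n(T^{ -1})\rangle,$$ and $$\langle S_n(T)\rangle \cong \langle S_n(T^{rc})\rangle.$$
   Context: $S_n$ is the symmetric group on $[n]=\{1,\dots,n\}$, permutations written in one-line notation $\pi=\pi_1\cdots\pi_n$, products composed right to left; $S=\bigcup_{n\ge 0}S_n$. A permutation $\pi\in S_n$ contains the pattern $\tau\in S_k$ if some subsequence $\pi_{i_1}\cdots\pi_{i_k}$ ($i_1<\dots<i_k$) is order-isomorphic to $\tau$; otherwise $\pi$ avoids $\tau$. For $T\subseteq S$, $S_n(T)$ is the set of permutations in $S_n$ avoiding every pattern in $T$, and $\langle A\rangle$ denotes the subgroup of $S_n$ generated by $A\subseteq S_n$. Let $\psi_n = n\,(n-1)\cdots 2\,1$. For $\pi\in S_n$, the reverse-complement is $\pi^{rc}=\psi_n\pi\psi_n$. For a set $A$ of permutations, $A^{ -1}=\{\sigma^{ -1}:\sigma\in A\}$ and $A^{rc}=\{\sigma^{rc}:\sigma\in A\}$. -}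

module Defs where

open import Data.Nat using (ℕ; suc)
open import Data.Fin using (Fin; opposite) renaming (_<_ to _<ᶠ_)
open import Data.Vec using (Vec; lookup; tabulate)
open import Data.Product using (Σ; _×_)
open import Data.Sum using (_⊎_)
open import Function.Bundles using (_⇔_)
open import Relation.Nullary using (¬_)
open import Relation.Binary.PropositionalEquality using (_≡_)

-- A "word" of length n over [n] in one-line notation (0-indexed: Fin n).
Word : ℕ → Set
Word n = Vec (Fin n) n

IsPerm : ∀ {n} → Word n → Set
IsPerm {n} v = ∀ (i j : Fin n) → lookup v i ≡ lookup v j → i ≡ j

-- Sets of words of every length (a set T ⊆ S is such a predicate whose
-- members are all permutations).
WordSet : Set₁
WordSet = ∀ {k} → Word k → Set

idP : ∀ {n} → Word n
idP = tabulate (λ i → i)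

_·_ : ∀ {n} → Word n → Word n → Word n
σ · τ = tabulate (λ i → lookup σ (lookup τ i))

_InverseOf_ : ∀ {n} → Word n → Word n → Set
τ InverseOf σ = ∀ i → lookup σ (lookup τ i) ≡ i

Contains : ∀ {n k} → Word n → Word k → Set
Contains {n} {k} π τ =
  Σ (Fin k → Fin n) λ f →
    (∀ i j → i <ᶠ j → f i <ᶠ f j) ×
    (∀ i j → (lookup τ i <ᶠ lookup τ j) ⇔ (lookup π (f i) <ᶠ lookup π (f j)))

Avoids : ∀ {n k} → Word n → Word k → Set
Avoids π τ = ¬ Contains π τ

Av : WordSet → (n : ℕ) → Word n → Set
Av T n π = IsPerm π × (∀ {k} (τ : Word k) → T τ → Avoids π τ)

reverseComplement : ∀ {n} → Word n → Word n
reverseComplement v = tabulate (λ i → opposite (lookup v (opposite i)))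

invSet : WordSet → WordSet
invSet T τ = Σ _ λ σ → T σ × (τ InverseOf σ)

rcSet : WordSet → WordSet
rcSet T τ = Σ _ λ σ → T σ × (τ ≡ reverseComplement σ)

_∪_ : ∀ {n} → (Word n → Set) → (Word n → Set) → Word n → Set
(A ∪ B) v = A v ⊎ B v

data ⟨_⟩ {n : ℕ} (A : Word n → Set) : Word n → Set where
  gen   : ∀ {σ} → A σ → ⟨ A ⟩ σ
  ident : ⟨ A ⟩ idP
  mul   : ∀ {σ τ} → ⟨ A ⟩ σ → ⟨ A ⟩ τ → ⟨ A ⟩ (σ · τ)
  inv   : ∀ {σ τ} → ⟨ A ⟩ σ → τ InverseOf σ → ⟨ A ⟩ τ

_≐_ : ∀ {n} → (Word n → Set) → (Word n → Set) → Set
H ≐ K = ∀ v → (H v → K v) × (K v → H v)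

record GroupIso {n : ℕ} (H K : Word n → Set) : Set where
  field
    to      : Word n → Word n
    from    : Word n → Word n
    to-mem  : ∀ σ → H σ → K (to σ)
    from-mem : ∀ σ → K σ → H (from σ)
    from-to : ∀ σ → H σ → from (to σ) ≡ σ
    to-from : ∀ σ → K σ → to (from σ) ≡ σ
    hom     : ∀ σ τ → H σ → H τ → to (σ · τ) ≡ to σ · to τ

-- Transposing the graph of a permutation turns an occurrence of a pattern τ in σ
-- into an occurrence of τ⁻¹ in σ⁻¹, so σ avoids T exactly when σ⁻¹ avoids T⁻¹.
-- Hence every generator of S_n(T) is the inverse of a generator of S_n(T⁻¹) and
-- vice versa, so both generate the same subgroup, which then also equals the one
-- generated by their union. Likewise reverse-complement, conjugation by ψ_n, maps
-- occurrences of τ to occurrences of τ^rc; being an involutive automorphism of S_n,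
-- it maps ⟨S_n(T)⟩ isomorphically onto ⟨S_n(T^rc)⟩.
module Submission where

open import Defs
open import Data.Nat using (ℕ; zero; suc; _≥_; s≤s)
open import Data.Nat.Properties using (1+n≰n; ∸-monoʳ-<)
open import Data.Product using (_×_; _,_; proj₁; proj₂; ∃)
open import Data.Sum using (inj₂; [_,_]′)
open import Data.Fin using (Fin; opposite; punchOut) renaming (_<_ to _<ᶠ_)
open import Data.Fin.Properties
  using (opposite-prop; opposite-involutive; toℕ<n; <-cmp; <-irrefl; <-asym; any?;
         punchOut-injective; injective⇒≤)
  renaming (_≟_ to _≟ᶠ_)
open import Data.Vec using (Vec; lookup; tabulate)
open import Data.Vec.Properties using (lookup∘tabulate; tabulate∘lookup; tabulate-cong)
open import Data.Empty using (⊥-elim)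
open import Function using (_∘_; id)
open import Function.Bundles using (_⇔_; mk⇔; Equivalence)
open import Function.Definitions using (Injective; Surjective)
open import Function.Construct.Composition using (_⇔-∘_)
open import Function.Construct.Symmetry using (⇔-sym)
open import Relation.Binary using (tri<; tri≈; tri>)
open import Relation.Binary.PropositionalEquality
open import Relation.Nullary using (yes; no)
open ≡-Reasoning

private
  variable
    n k : ℕ

  rc : Word n → Word n
  rc = reverseComplement

lookup-≗⇒≡ : ∀ {A : Set} {u v : Vec A n} → (∀ i → lookup u i ≡ lookup v i) → u ≡ v
lookup-≗⇒≡ {u = u} {v} u≗v = begin
  u                   ≡⟨ tabulate∘lookup u ⟨
  tabulate (lookup u) ≡⟨ tabulate-cong u≗v ⟩
  tabulate (lookup v) ≡⟨ tabulate∘lookup v ⟩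
  v                   ∎

lookup-idP : ∀ (i : Fin n) → lookup idP i ≡ i
lookup-idP = lookup∘tabulate id

lookup-· : ∀ (σ τ : Word n) i → lookup (σ · τ) i ≡ lookup σ (lookup τ i)
lookup-· σ τ = lookup∘tabulate _

lookup-rc : ∀ (v : Word n) i → lookup (rc v) i ≡ opposite (lookup v (opposite i))
lookup-rc v = lookup∘tabulate _

injective⇒surjective : ∀ {f : Fin n → Fin n} → Injective _≡_ _≡_ f → Surjective _≡_ _≡_ f
injective⇒surjective {zero} _ ()
injective⇒surjective {suc m} {f} f-inj y with any? (λ x → f x ≟ᶠ y)
... | yes (x , fx≡y) = x , λ { refl → fx≡y }
... | no y∉image = ⊥-elim (1+n≰n (injective⇒≤ squeeze-injective))
  where
  -- a value missed by f lets punchOut squeeze f into an injection Fin (suc m) → Fin m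
  y≢f : ∀ x → y ≢ f x
  y≢f x y≡fx = y∉image (x , sym y≡fx)

  squeeze : Fin (suc m) → Fin m
  squeeze x = punchOut (y≢f x)

  squeeze-injective : Injective _≡_ _≡_ squeeze
  squeeze-injective {a} {b} = f-inj ∘ punchOut-injective (y≢f a) (y≢f b)

increasing⇒order-embedding : ∀ {f : Fin k → Fin n} → (∀ i j → i <ᶠ j → f i <ᶠ f j) →
                             ∀ {i j} → (i <ᶠ j) ⇔ (f i <ᶠ f j)
increasing⇒order-embedding {f = f} f-inc {i} {j} = mk⇔ (f-inc i j) reflect
  where
  reflect : f i <ᶠ f j → i <ᶠ j
  reflect fi<fj with <-cmp i j
  ... | tri< i<j _ _ = i<j
  ... | tri≈ _ refl _ = ⊥-elim (<-irrefl refl fi<fj)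
  ... | tri> _ _ j<i = ⊥-elim (<-asym fi<fj (f-inc j i j<i))

opposite-injective : Injective _≡_ _≡_ (opposite {n})
opposite-injective {x = i} {j} opp-i≡opp-j = begin
  i                     ≡⟨ opposite-involutive i ⟨
  opposite (opposite i) ≡⟨ cong opposite opp-i≡opp-j ⟩
  opposite (opposite j) ≡⟨ opposite-involutive j ⟩
  j                     ∎

opposite-< : ∀ {i j : Fin n} → i <ᶠ j → opposite j <ᶠ opposite i
opposite-< {i = i} {j} i<j rewrite opposite-prop i | opposite-prop j =
  ∸-monoʳ-< (s≤s i<j) (toℕ<n j)

opposite-<-⇔ : ∀ {i j : Fin n} → (opposite i <ᶠ opposite j) ⇔ (j <ᶠ i)
opposite-<-⇔ {i = i} {j} = mk⇔ reflect opposite-<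
  where
  reflect : opposite i <ᶠ opposite j → j <ᶠ i
  reflect opp-i<opp-j =
    subst₂ _<ᶠ_ (opposite-involutive j) (opposite-involutive i) (opposite-< opp-i<opp-j)

InverseOf⇒IsPerm : ∀ (σ τ : Word n) → τ InverseOf σ → IsPerm τ
InverseOf⇒IsPerm σ τ σ∘τ≗id i j τi≡τj = begin
  i                     ≡⟨ σ∘τ≗id i ⟨
  lookup σ (lookup τ i) ≡⟨ cong (lookup σ) τi≡τj ⟩
  lookup σ (lookup τ j) ≡⟨ σ∘τ≗id j ⟩
  j                     ∎

InverseOf-flip : ∀ (σ τ : Word n) → IsPerm σ → τ InverseOf σ → σ InverseOf τ
InverseOf-flip σ τ σ-perm σ∘τ≗id i = σ-perm _ i (σ∘τ≗id (lookup σ i))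

IsPerm⇒inverse : ∀ (σ : Word n) → IsPerm σ → ∃ λ σ⁻¹ → σ⁻¹ InverseOf σ
IsPerm⇒inverse σ σ-perm = tabulate preimage , λ i → begin
  lookup σ (lookup (tabulate preimage) i) ≡⟨ cong (lookup σ) (lookup∘tabulate preimage i) ⟩
  lookup σ (preimage i)                  ≡⟨ proj₂ (onto i) refl ⟩
  i                                      ∎
  where
  onto = injective⇒surjective (σ-perm _ _)
  preimage = proj₁ ∘ onto

Contains-inverse : ∀ (π π⁻¹ : Word n) (α α⁻¹ : Word k) →
                   π InverseOf π⁻¹ → α⁻¹ InverseOf α → Contains π α → Contains π⁻¹ α⁻¹
Contains-inverse {n} {k} π π⁻¹ α α⁻¹ π⁻¹∘π≗id α∘α⁻¹≗id (f , f-inc , f-iso) =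
  g , g-inc , g-iso
  where
  g : Fin k → Fin n
  g j = lookup π (f (lookup α⁻¹ j))

  g-inc : ∀ i j → i <ᶠ j → g i <ᶠ g j
  g-inc i j i<j = Equivalence.to (f-iso (lookup α⁻¹ i) (lookup α⁻¹ j))
    (subst₂ _<ᶠ_ (sym (α∘α⁻¹≗id i)) (sym (α∘α⁻¹≗id j)) i<j)

  g-iso : ∀ i j → (lookup α⁻¹ i <ᶠ lookup α⁻¹ j) ⇔ (lookup π⁻¹ (g i) <ᶠ lookup π⁻¹ (g j))
  g-iso i j rewrite π⁻¹∘π≗id (f (lookup α⁻¹ i)) | π⁻¹∘π≗id (f (lookup α⁻¹ j)) =
    increasing⇒order-embedding f-inc

opposite-lookup-rc : ∀ (v : Word n) i → opposite (lookup (rc v) i) ≡ lookup v (opposite i)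
opposite-lookup-rc v i = begin
  opposite (lookup (rc v) i)                  ≡⟨ cong opposite (lookup-rc v i) ⟩
  opposite (opposite (lookup v (opposite i))) ≡⟨ opposite-involutive _ ⟩
  lookup v (opposite i)                       ∎

lookup-rc∘rc : ∀ (σ τ : Word n) i →
               lookup (rc σ) (lookup (rc τ) i) ≡ opposite (lookup σ (lookup τ (opposite i)))
lookup-rc∘rc σ τ i = begin
  lookup (rc σ) (lookup (rc τ) i)                  ≡⟨ lookup-rc σ _ ⟩
  opposite (lookup σ (opposite (lookup (rc τ) i)))
    ≡⟨ cong (opposite ∘ lookup σ) (opposite-lookup-rc τ i) ⟩
  opposite (lookup σ (lookup τ (opposite i)))      ∎

rc-involutive : ∀ (v : Word n) → rc (rc v) ≡ v
rc-involutive v = lookup-≗⇒≡ λ i → begin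
  lookup (rc (rc v)) i                  ≡⟨ lookup-rc (rc v) i ⟩
  opposite (lookup (rc v) (opposite i)) ≡⟨ opposite-lookup-rc v (opposite i) ⟩
  lookup v (opposite (opposite i))      ≡⟨ cong (lookup v) (opposite-involutive i) ⟩
  lookup v i                            ∎

rc-idP : rc idP ≡ idP {n}
rc-idP = lookup-≗⇒≡ λ i → begin
  lookup (rc idP) i                  ≡⟨ lookup-rc idP i ⟩
  opposite (lookup idP (opposite i)) ≡⟨ cong opposite (lookup-idP (opposite i)) ⟩
  opposite (opposite i)              ≡⟨ opposite-involutive i ⟩
  i                                  ≡⟨ lookup-idP i ⟨
  lookup idP i                       ∎

rc-· : ∀ (σ τ : Word n) → rc (σ · τ) ≡ rc σ · rc τ
rc-· σ τ = lookup-≗⇒≡ λ i → begin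
  lookup (rc (σ · τ)) i                       ≡⟨ lookup-rc (σ · τ) i ⟩
  opposite (lookup (σ · τ) (opposite i))      ≡⟨ cong opposite (lookup-· σ τ (opposite i)) ⟩
  opposite (lookup σ (lookup τ (opposite i))) ≡⟨ lookup-rc∘rc σ τ i ⟨
  lookup (rc σ) (lookup (rc τ) i)             ≡⟨ lookup-· (rc σ) (rc τ) i ⟨
  lookup (rc σ · rc τ) i                      ∎

rc-InverseOf : ∀ (σ τ : Word n) → τ InverseOf σ → rc τ InverseOf rc σ
rc-InverseOf σ τ σ∘τ≗id i = begin
  lookup (rc σ) (lookup (rc τ) i)             ≡⟨ lookup-rc∘rc σ τ i ⟩
  opposite (lookup σ (lookup τ (opposite i))) ≡⟨ cong opposite (σ∘τ≗id (opposite i)) ⟩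
  opposite (opposite i)                       ≡⟨ opposite-involutive i ⟩
  i                                           ∎

rc-IsPerm : ∀ (σ : Word n) → IsPerm σ → IsPerm (rc σ)
rc-IsPerm σ σ-perm i j rcσi≡rcσj = opposite-injective (σ-perm _ _ (opposite-injective
  (subst₂ _≡_ (lookup-rc σ i) (lookup-rc σ j) rcσi≡rcσj)))

Contains-rc : ∀ (π : Word n) (α : Word k) → Contains π α → Contains (rc π) (rc α)
Contains-rc {n} {k} π α (f , f-inc , f-iso) = g , g-inc , g-iso
  where
  g : Fin k → Fin n
  g i = opposite (f (opposite i))

  g-inc : ∀ i j → i <ᶠ j → g i <ᶠ g j
  g-inc i j = opposite-< ∘ f-inc _ _ ∘ opposite-<

  lookup-rcπ∘g : ∀ i → lookup (rc π) (g i) ≡ opposite (lookup π (f (opposite i)))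
  lookup-rcπ∘g i = begin
    lookup (rc π) (g i)                  ≡⟨ lookup-rc π (g i) ⟩
    opposite (lookup π (opposite (g i))) ≡⟨ cong (opposite ∘ lookup π) (opposite-involutive _) ⟩
    opposite (lookup π (f (opposite i))) ∎

  g-iso : ∀ i j → (lookup (rc α) i <ᶠ lookup (rc α) j) ⇔
                  (lookup (rc π) (g i) <ᶠ lookup (rc π) (g j))
  g-iso i j rewrite lookup-rc α i | lookup-rc α j | lookup-rcπ∘g i | lookup-rcπ∘g j =
    ⇔-sym opposite-<-⇔ ⇔-∘ (f-iso (opposite j) (opposite i) ⇔-∘ opposite-<-⇔)

module _ {A B : Word n → Set} (φ : Word n → Word n) (φ-idP : φ idP ≡ idP)
         (φ-· : ∀ σ τ → φ (σ · τ) ≡ φ σ · φ τ)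
         (φ-InverseOf : ∀ σ τ → τ InverseOf σ → φ τ InverseOf φ σ)
         (A⇒⟨B⟩∘φ : ∀ {σ} → A σ → ⟨ B ⟩ (φ σ)) where

  ⟨⟩-map : ∀ {σ} → ⟨ A ⟩ σ → ⟨ B ⟩ (φ σ)
  ⟨⟩-map (gen a)               = A⇒⟨B⟩∘φ a
  ⟨⟩-map ident                 = subst ⟨ B ⟩ (sym φ-idP) ident
  ⟨⟩-map (mul {σ} {τ} x y)     = subst ⟨ B ⟩ (sym (φ-· σ τ)) (mul (⟨⟩-map x) (⟨⟩-map y))
  ⟨⟩-map (inv {σ} {τ} x τ-inv) = inv (⟨⟩-map x) (φ-InverseOf σ τ τ-inv)

⟨⟩-least : ∀ {A B : Word n → Set} → (∀ {σ} → A σ → ⟨ B ⟩ σ) → ∀ {σ} → ⟨ A ⟩ σ → ⟨ B ⟩ σ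
⟨⟩-least = ⟨⟩-map id refl (λ _ _ → refl) (λ _ _ → id)

⟨⟩-rc : ∀ {A B : Word n → Set} → (∀ σ → A σ → B (rc σ)) → ∀ {σ} → ⟨ A ⟩ σ → ⟨ B ⟩ (rc σ)
⟨⟩-rc A⇒B∘rc = ⟨⟩-map rc rc-idP rc-· rc-InverseOf (λ {σ} → gen ∘ A⇒B∘rc σ)

∈⟨⟩-by-inverse : ∀ {B : Word n → Set} {σ : Word n} → IsPerm σ →
                 (∀ σ⁻¹ → σ⁻¹ InverseOf σ → B σ⁻¹) → ⟨ B ⟩ σ
∈⟨⟩-by-inverse {σ = σ} σ-perm inverse∈B with σ⁻¹ , σ∘σ⁻¹≗id ← IsPerm⇒inverse σ σ-perm =
  inv (gen (inverse∈B σ⁻¹ σ∘σ⁻¹≗id)) (InverseOf-flip σ σ⁻¹ σ-perm σ∘σ⁻¹≗id)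

module _ (T : WordSet) (T-perms : ∀ {k} (τ : Word k) → T τ → IsPerm τ) {n : ℕ} where

  Av-inverse : ∀ (σ σ⁻¹ : Word n) → σ⁻¹ InverseOf σ → Av T n σ → Av (invSet T) n σ⁻¹
  Av-inverse σ σ⁻¹ σ∘σ⁻¹≗id (_ , σ-avoids) = InverseOf⇒IsPerm σ σ⁻¹ σ∘σ⁻¹≗id , λ where
    τ (ρ , Tρ , ρ∘τ≗id) σ⁻¹-contains →
      σ-avoids ρ Tρ (Contains-inverse σ⁻¹ σ τ ρ σ∘σ⁻¹≗id
        (InverseOf-flip ρ τ (T-perms ρ Tρ) ρ∘τ≗id) σ⁻¹-contains)

  Av-invSet-inverse : ∀ (σ σ⁻¹ : Word n) → σ⁻¹ InverseOf σ → Av (invSet T) n σ → Av T n σ⁻¹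
  Av-invSet-inverse σ σ⁻¹ σ∘σ⁻¹≗id (_ , σ-avoids) = InverseOf⇒IsPerm σ σ⁻¹ σ∘σ⁻¹≗id ,
    λ τ Tτ σ⁻¹-contains →
      let τ⁻¹ , τ∘τ⁻¹≗id = IsPerm⇒inverse τ (T-perms τ Tτ)
      in σ-avoids τ⁻¹ (τ , Tτ , τ∘τ⁻¹≗id)
           (Contains-inverse σ⁻¹ σ τ τ⁻¹ σ∘σ⁻¹≗id τ∘τ⁻¹≗id σ⁻¹-contains)

  Av⊆⟨Av-invSet⟩ : ∀ {σ : Word n} → Av T n σ → ⟨ Av (invSet T) n ⟩ σ
  Av⊆⟨Av-invSet⟩ {σ} σ∈Av =
    ∈⟨⟩-by-inverse (proj₁ σ∈Av) (λ σ⁻¹ inverse → Av-inverse σ σ⁻¹ inverse σ∈Av)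

  Av-invSet⊆⟨Av⟩ : ∀ {σ : Word n} → Av (invSet T) n σ → ⟨ Av T n ⟩ σ
  Av-invSet⊆⟨Av⟩ {σ} σ∈Av =
    ∈⟨⟩-by-inverse (proj₁ σ∈Av) (λ σ⁻¹ inverse → Av-invSet-inverse σ σ⁻¹ inverse σ∈Av)

module _ (T : WordSet) {n : ℕ} where

  Av-rc : ∀ (σ : Word n) → Av T n σ → Av (rcSet T) n (rc σ)
  Av-rc σ (σ-perm , σ-avoids) = rc-IsPerm σ σ-perm , λ where
    τ (ρ , Tρ , refl) rcσ-contains →
      σ-avoids ρ Tρ (subst₂ Contains (rc-involutive σ) (rc-involutive ρ)
        (Contains-rc (rc σ) (rc ρ) rcσ-contains))

  Av-rcSet-rc : ∀ (σ : Word n) → Av (rcSet T) n σ → Av T n (rc σ)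
  Av-rcSet-rc σ (σ-perm , σ-avoids) = rc-IsPerm σ σ-perm , λ τ Tτ rcσ-contains →
    σ-avoids (rc τ) (τ , Tτ , refl)
      (subst (λ π → Contains π (rc τ)) (rc-involutive σ) (Contains-rc (rc σ) τ rcσ-contains))

lemma3p3 : (T : WordSet) → (∀ {k} (τ : Word k) → T τ → IsPerm τ) →
           (n : ℕ) → n ≥ 1 →
           (⟨ Av T n ⟩ ≐ ⟨ Av (invSet T) n ⟩) ×
           (⟨ Av (invSet T) n ⟩ ≐ ⟨ Av T n ∪ Av (invSet T) n ⟩) ×
           GroupIso ⟨ Av T n ⟩ ⟨ Av (rcSet T) n ⟩
lemma3p3 T T-perms _ _ =
  (λ _ → ⟨⟩-least (Av⊆⟨Av-invSet⟩ T T-perms) , ⟨⟩-least (Av-invSet⊆⟨Av⟩ T T-perms)) ,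
  (λ _ → ⟨⟩-least (gen ∘ inj₂) , ⟨⟩-least [ Av⊆⟨Av-invSet⟩ T T-perms , gen ]′) ,
  record
    { to       = rc
    ; from     = rc
    ; to-mem   = λ _ → ⟨⟩-rc (Av-rc T)
    ; from-mem = λ _ → ⟨⟩-rc (Av-rcSet-rc T)
    ; from-to  = λ σ _ → rc-involutive σ
    ; to-from  = λ σ _ → rc-involutive σ
    ; hom      = λ σ τ _ _ → rc-· σ τ
    }
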